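{- Let $G=(P,N,E)$ be a proper tagged probe interval graph such that $G_P$ is a connected reduced proper interval graph with a canonical ordering $u_1,u_2,\dots,u_p$ of its vertices, and let $\mathcal{V}$ be the corresponding vertex canonical sequence of $G_P$. Let $w\in N$ have at least two neighbors in $P$, and let $T_1$ and $T_2$ be two perfect substrings for $w$ in $\mathcal{V}$ intersecting in exactly one place (position). Then one of the following holds: (1) $\mathcal{V}$ begins with $u_1u_2u_1$ and only $u_1$ and $u_2$ are neighbors of $w$; (2) $\mathcal{V}$ ends with $u_pu_{p-1}u_p$ and only $u_{p-1}$ and $u_p$ are neighbors of $w$.
   Context: $G_P$ is the subgraph induced by the probe set $P$. A proper tagged probe interval graph with probes $P$ and nonprobes $N$ is a graph for which there are closed intervals $I_x=[\ell_x,r_x]$ such that $N$ is independent; for $x,y\in P$, $xy\in E$ iff $I_x\cap I_y\ne\emptyset$; for $x\in P,y\in N$, $xy\in E$ iff $\ell_x\in I_y$ or $r_x\in I_y$; and $\{I_x:x\in P\}$ is a proper interval representation of $G_P$. A graph is reduced if no two vertices have the same closed neighborhood. A canonical ordering $u_1,\dots,u_p$ of a proper interval graph is one with a proper interval representation $\{[a_i,b_i]\}$ satisfying $a_i\ne b_j$ for all $i,j$, $a_1<\dots<a_p$, $b_1<\dots<b_p$; the vertex canonical sequence lists the $2p$ endpoints in increasing order with each $a_i$ and $b_i$ replaced by $u_i$. A substring is a contiguous stretch of the sequence; a perfect substring of $w$ is a substring all of whose entries are neighbors of $w$ and containing every neighbor of $w$ in $P$ at least once.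
   Formalization: The intervals $I_x$ of the proper tagged probe interval representation and the intervals of the proper interval representation witnessing the canonical ordering have rational endpoints. -}

module Defs where

open import Level using (0ℓ)
open import Data.Nat as ℕ using (ℕ; _+_; _∸_)
open import Data.Fin as Fin using (Fin; toℕ; splitAt)
open import Data.Sum using (_⊎_; inj₁; inj₂; [_,_]′)
open import Data.Product using (Σ; _×_; _,_; ∃; ∃-syntax)
open import Data.Rational as ℚ using (ℚ)
open import Relation.Binary.PropositionalEquality using (_≡_; _≢_)
open import Relation.Nullary using (¬_)
open import Function using (id)
open import Function.Bundles using (_⇔_)
open import Function.Definitions using (Bijective)

record SimpleGraph (V : Set) : Set₁ where
  field
    Adj    : V → V → Set
    sym    : ∀ {x y} → Adj x y → Adj y x
    irrefl : ∀ {x} → ¬ Adj x x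

open SimpleGraph public

-- Vertex set of a probe graph: probes P = Fin p, nonprobes N = Fin q.
Vtx : ℕ → ℕ → Set
Vtx p q = Fin p ⊎ Fin q

_∈[_,_] : ℚ → ℚ → ℚ → Set
x ∈[ a , b ] = (a ℚ.≤ x) × (x ℚ.≤ b)

Meets : ℚ → ℚ → ℚ → ℚ → Set
Meets a b c d = (a ℚ.≤ d) × (c ℚ.≤ b)

ProperSub : ℚ → ℚ → ℚ → ℚ → Set
ProperSub a b c d = (c ℚ.≤ a) × (b ℚ.≤ d) × ((c ℚ.< a) ⊎ (b ℚ.< d))

record IsProperTPIG {p q : ℕ} (G : SimpleGraph (Vtx p q)) : Set where
  field
    ℓ r     : Vtx p q → ℚ
    ℓ≤r     : ∀ v → ℓ v ℚ.≤ r v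
    N-indep : ∀ y y′ → ¬ Adj G (inj₂ y) (inj₂ y′)
    PP      : ∀ x y → x ≢ y →
              Adj G (inj₁ x) (inj₁ y) ⇔ Meets (ℓ (inj₁ x)) (r (inj₁ x)) (ℓ (inj₁ y)) (r (inj₁ y))
    PN      : ∀ x y →
              Adj G (inj₁ x) (inj₂ y) ⇔
                ((ℓ (inj₁ x) ∈[ ℓ (inj₂ y) , r (inj₂ y) ]) ⊎ (r (inj₁ x) ∈[ ℓ (inj₂ y) , r (inj₂ y) ]))
    proper  : ∀ x y → x ≢ y →
              ¬ ProperSub (ℓ (inj₁ x)) (r (inj₁ x)) (ℓ (inj₁ y)) (r (inj₁ y))

AdjP : ∀ {p q} → SimpleGraph (Vtx p q) → Fin p → Fin p → Set
AdjP G x y = Adj G (inj₁ x) (inj₁ y)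

data Reach {A : Set} (R : A → A → Set) : A → A → Set where
  here : ∀ {x} → Reach R x x
  step : ∀ {x y z} → R x y → Reach R y z → Reach R x z

ConnectedP : ∀ {p q} → SimpleGraph (Vtx p q) → Set
ConnectedP G = ∀ x y → Reach (AdjP G) x y

NbhdP : ∀ {p q} → SimpleGraph (Vtx p q) → Fin p → Fin p → Set
NbhdP G x z = (z ≡ x) ⊎ AdjP G x z

ReducedP : ∀ {p q} → SimpleGraph (Vtx p q) → Set
ReducedP {p} G = ∀ x y → (∀ z → NbhdP G x z ⇔ NbhdP G y z) → x ≡ y

-- Canonical ordering u_1,…,u_p of G_P (u i is u_{i+1}), witnessed by
-- the proper interval representation {[a i , b i]} of G_P.

record IsCanonicalOrdering {p q : ℕ} (G : SimpleGraph (Vtx p q))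
         (u : Fin p → Fin p) (a b : Fin p → ℚ) : Set where
  field
    u-bij   : Bijective _≡_ _≡_ u
    a≤b     : ∀ i → a i ℚ.≤ b i
    rep     : ∀ i j → i ≢ j → AdjP G (u i) (u j) ⇔ Meets (a i) (b i) (a j) (b j)
    proper  : ∀ i j → i ≢ j → ¬ ProperSub (a i) (b i) (a j) (b j)
    a≢b     : ∀ i j → a i ≢ b j
    a-mono  : ∀ i j → i Fin.< j → a i ℚ.< a j
    b-mono  : ∀ i j → i Fin.< j → b i ℚ.< b j

-- Vertex canonical sequence.  The 2p endpoints are indexed by
-- Fin (p + p): the first p are a_1..a_p, the last p are b_1..b_p.

endpoint : ∀ {p} → (Fin p → ℚ) → (Fin p → ℚ) → Fin (p + p) → ℚ
endpoint {p} a b k = [ a , b ]′ (splitAt p k)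

endpointLabel : ∀ {p} → Fin (p + p) → Fin p
endpointLabel {p} k = [ id , id ]′ (splitAt p k)

-- V lists the endpoints in increasing order, each replaced by (the index of)
-- its vertex: V k = i means the k-th entry (0-based) is u_{i+1}.
IsVertexCanonicalSequence : ∀ {p} → (Fin p → ℚ) → (Fin p → ℚ) → (Fin (p + p) → Fin p) → Set
IsVertexCanonicalSequence {p} a b V =
  Σ (Fin (p + p) → Fin (p + p)) λ σ →
    Bijective _≡_ _≡_ σ ×
    (∀ k l → k Fin.< l → endpoint a b (σ k) ℚ.< endpoint a b (σ l)) ×
    (∀ k → V k ≡ endpointLabel (σ k))

InSub : ∀ {n} → Fin n → Fin n → Fin n → Set
InSub s t k = (s Fin.≤ k) × (k Fin.≤ t)

NbrW : ∀ {p q} → SimpleGraph (Vtx p q) → Fin q → Fin p → Set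
NbrW G w x = Adj G (inj₁ x) (inj₂ w)

PerfectSub : ∀ {p q} → SimpleGraph (Vtx p q) → (Fin p → Fin p) →
             (Fin (p + p) → Fin p) → Fin q → Fin (p + p) → Fin (p + p) → Set
PerfectSub G u V w s t =
  (s Fin.≤ t) ×
  (∀ k → InSub s t k → NbrW G w (u (V k))) ×
  (∀ x → NbrW G w x → ∃[ k ] (InSub s t k × (u (V k) ≡ x)))

MeetInOnePlace : ∀ {n} → Fin n → Fin n → Fin n → Fin n → Set
MeetInOnePlace s₁ t₁ s₂ t₂ =
  (∃[ k ] (InSub s₁ t₁ k × InSub s₂ t₂ k)) ×
  (∀ k k′ → InSub s₁ t₁ k × InSub s₂ t₂ k → InSub s₁ t₁ k′ × InSub s₂ t₂ k′ → k ≡ k′)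

TwoNbrs : ∀ {p q} → SimpleGraph (Vtx p q) → Fin q → Set
TwoNbrs G w = ∃[ x ] ∃[ y ] (x ≢ y × NbrW G w x × NbrW G w y)

-- The two alternatives of the conclusion (0-based indices).

Case1 : ∀ {p q} → SimpleGraph (Vtx p q) → (Fin p → Fin p) →
        (Fin (p + p) → Fin p) → Fin q → Set
Case1 {p} G u V w =
  (∃[ k₀ ] ∃[ k₁ ] ∃[ k₂ ]
     ((toℕ k₀ ≡ 0) × (toℕ k₁ ≡ 1) × (toℕ k₂ ≡ 2) ×
      (toℕ (V k₀) ≡ 0) × (toℕ (V k₁) ≡ 1) × (toℕ (V k₂) ≡ 0))) ×
  (∀ i → NbrW G w (u i) ⇔ ((toℕ i ≡ 0) ⊎ (toℕ i ≡ 1)))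

Case2 : ∀ {p q} → SimpleGraph (Vtx p q) → (Fin p → Fin p) →
        (Fin (p + p) → Fin p) → Fin q → Set
Case2 {p} G u V w =
  (∃[ k₀ ] ∃[ k₁ ] ∃[ k₂ ]
     ((toℕ k₀ ≡ (p + p) ∸ 3) × (toℕ k₁ ≡ (p + p) ∸ 2) × (toℕ k₂ ≡ (p + p) ∸ 1) ×
      (toℕ (V k₀) ≡ p ∸ 1) × (toℕ (V k₁) ≡ p ∸ 2) × (toℕ (V k₂) ≡ p ∸ 1))) ×
  (∀ i → NbrW G w (u i) ⇔ ((toℕ i ≡ p ∸ 2) ⊎ (toℕ i ≡ p ∸ 1)))

-- In the vertex canonical sequence u_i occurs at positions left i < right i, both increasing in i,
-- and u_i u_j is an edge iff these position intervals overlap.  Connectivity forces consecutive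
-- intervals to overlap; reducedness forbids consecutive vertices whose left and right occurrences
-- are both adjacent positions, since they would be twins.  Two perfect substrings meeting in one
-- place share an end position k, labelled x, and every other neighbour of w occurs once strictly
-- on each side of k.  If k is the left occurrence of x, all other neighbours precede x, so the
-- predecessor z of x is a neighbour; a predecessor of z would be a neighbour and a twin of z.
-- Hence z = u_1, x = u_2, and the sequence begins u_1 u_2 u_1.  If k is the right occurrence of x,
-- the same argument applies to the reversed sequence.
module Submission where

open import Defs hiding (sym)
open import Data.Nat as ℕ using (ℕ; suc; _+_; _∸_; z≤n; s≤s)
import Data.Nat.Properties as ℕ
open import Data.Fin as Fin using (Fin; toℕ; _<_; _≤_; fromℕ<; inject₁; opposite; _↑ˡ_; _↑ʳ_)
import Data.Fin.Properties as Fin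
open import Data.Sum using (_⊎_; inj₁; inj₂; [_,_]′)
open import Data.Rational as ℚ using (ℚ)
import Data.Rational.Properties as ℚ
open import Data.Product using (Σ; _×_; _,_; proj₁; proj₂; ∃-syntax)
open import Data.Empty using (⊥; ⊥-elim)
open import Relation.Binary.PropositionalEquality
open import Relation.Binary.Definitions using (Irreflexive; Asymmetric; tri<; tri≈; tri>)
open import Relation.Nullary using (yes; no)
open import Function.Base using (_∘_; id)
open import Function.Definitions using (Surjective)
open import Function.Bundles using (_⇔_; mk⇔; Equivalence)
open import Function.Properties.Equivalence using () renaming (trans to ⇔-trans; sym to ⇔-sym)

no-index-between : ∀ {a b c : ℕ} → c ≡ suc a → a ℕ.< b → b ℕ.< c → ⊥
no-index-between refl a<b b<c = ℕ.<⇒≱ a<b (ℕ.s≤s⁻¹ b<c)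

nothing-between⇒≡suc : ∀ {n a} {b : Fin n} → a ℕ.< toℕ b →
                       (∀ m → a ℕ.< toℕ m → m < b → ⊥) → toℕ b ≡ suc a
nothing-between⇒≡suc {b = b} a<b empty with ℕ.m≤n⇒m<n∨m≡n a<b
... | inj₂ eq = sym eq
... | inj₁ sa<b = ⊥-elim (empty m (ℕ.≤-reflexive (sym toℕm)) (subst (ℕ._< toℕ b) (sym toℕm) sa<b))
  where
  m = fromℕ< (ℕ.<-trans sa<b (Fin.toℕ<n b))
  toℕm = Fin.toℕ-fromℕ< (ℕ.<-trans sa<b (Fin.toℕ<n b))

∃-predecessor : ∀ {n} {x : Fin n} → 0 ℕ.< toℕ x → Σ (Fin n) λ z → toℕ x ≡ suc (toℕ z)
∃-predecessor {suc n} {Fin.suc z} _ = inject₁ z , cong suc (sym (Fin.toℕ-inject₁ z))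

module _ {m : ℕ} {B : Set} {_≺_ : B → B → Set}
         (irrefl : Irreflexive _≡_ _≺_) (asym : Asymmetric _≺_)
         {f : Fin m → B} (mono : ∀ {i j} → i < j → f i ≺ f j) where

  strictMono-reflects-< : ∀ {i j} → f i ≺ f j → i < j
  strictMono-reflects-< {i} {j} fi≺fj with Fin.<-cmp i j
  ... | tri< i<j _ _ = i<j
  ... | tri≈ _ refl _ = ⊥-elim (irrefl refl fi≺fj)
  ... | tri> _ _ j<i = ⊥-elim (asym fi≺fj (mono j<i))

strictMono-mono-≤ : ∀ {m n} {f : Fin m → Fin n} → (∀ {i j} → i < j → f i < f j) →
                    ∀ {i j} → i ≤ j → f i ≤ f j
strictMono-mono-≤ mono i≤j =
  ℕ.≮⇒≥ (λ fj<fi → ℕ.<⇒≱ (strictMono-reflects-< ℕ.<-irrefl ℕ.<-asym mono fj<fi) i≤j)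

-- The combinatorial content of a vertex canonical sequence: each of the p vertices occurs at
-- exactly two of the n positions, left i < right i, and both occurrences increase with i.
record EndpointSequence (p n : ℕ) : Set where
  field
    lab           : Fin n → Fin p
    left right    : Fin p → Fin n
    lab-left      : ∀ i → lab (left i) ≡ i
    lab-right     : ∀ i → lab (right i) ≡ i
    left-or-right : ∀ k → left (lab k) ≡ k ⊎ right (lab k) ≡ k
    left<right    : ∀ i → left i < right i
    left-mono     : ∀ {i j} → i < j → left i < left j
    right-mono    : ∀ {i j} → i < j → right i < right j

module EndpointSequenceProperties {p n} (E : EndpointSequence p n) where
  open EndpointSequence E public

  Overlap : Fin p → Fin p → Set
  Overlap i j = left i < right j × left j < right i

  occurrence : ∀ {m i} → lab m ≡ i → m ≡ left i ⊎ m ≡ right i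
  occurrence {m} refl with left-or-right m
  ... | inj₁ e = inj₁ (sym e)
  ... | inj₂ e = inj₂ (sym e)

  ordered-occurrences : ∀ {m₁ m₂ i} → lab m₁ ≡ i → lab m₂ ≡ i → m₁ < m₂ →
                        m₁ ≡ left i × m₂ ≡ right i
  ordered-occurrences e₁ e₂ m₁<m₂ with occurrence e₁ | occurrence e₂
  ... | inj₁ refl | inj₁ refl = ⊥-elim (ℕ.<-irrefl refl m₁<m₂)
  ... | inj₁ refl | inj₂ refl = refl , refl
  ... | inj₂ refl | inj₁ refl = ⊥-elim (ℕ.<-asym m₁<m₂ (left<right _))
  ... | inj₂ refl | inj₂ refl = ⊥-elim (ℕ.<-irrefl refl m₁<m₂)

  left≢right : ∀ i j → left i ≢ right j
  left≢right i j e with trans (sym (lab-left i)) (trans (cong lab e) (lab-right j))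
  ... | refl = ℕ.<-irrefl (cong toℕ e) (left<right i)

  left-lab≤ : ∀ k → left (lab k) ≤ k
  left-lab≤ k with left-or-right k
  ... | inj₁ e = ℕ.≤-reflexive (cong toℕ e)
  ... | inj₂ e = ℕ.<⇒≤ (subst (λ m → left (lab k) < m) e (left<right (lab k)))

  left-reflects-< : ∀ {i j} → left i < left j → i < j
  left-reflects-< = strictMono-reflects-< ℕ.<-irrefl ℕ.<-asym left-mono

  right-reflects-< : ∀ {i j} → right i < right j → i < j
  right-reflects-< = strictMono-reflects-< ℕ.<-irrefl ℕ.<-asym right-mono

  left-first : ∀ i → toℕ i ≡ 0 → toℕ (left i) ≡ 0
  left-first i i≡0 = ℕ.n≤0⇒n≡0 (begin
      toℕ (left i)        ≤⟨ strictMono-mono-≤ left-mono (subst (ℕ._≤ toℕ (lab m₀)) (sym i≡0) z≤n) ⟩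
      toℕ (left (lab m₀)) ≤⟨ left-lab≤ m₀ ⟩
      toℕ m₀              ≡⟨ Fin.toℕ-fromℕ< _ ⟩
      0                   ∎)
    where
    open ℕ.≤-Reasoning
    m₀ : Fin n
    m₀ = fromℕ< (ℕ.≤-<-trans z≤n (Fin.toℕ<n (left i)))

  lefts-between⇒adjacent : ∀ {i j} → toℕ j ≡ suc (toℕ i) →
    (∀ m → left i < m → m < left j → left (lab m) ≡ m) →
    toℕ (left j) ≡ suc (toℕ (left i))
  lefts-between⇒adjacent {i} {j} j≡1+i allLeft =
    nothing-between⇒≡suc (left-mono (ℕ.≤-reflexive (sym j≡1+i))) λ m i<m m<j →
      let e = allLeft m i<m m<j in
      no-index-between j≡1+i (left-reflects-< (subst (left i <_) (sym e) i<m))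
                             (left-reflects-< (subst (_< left j) (sym e) m<j))

  rights-between⇒adjacent : ∀ {i j} → toℕ j ≡ suc (toℕ i) →
    (∀ m → right i < m → m < right j → right (lab m) ≡ m) →
    toℕ (right j) ≡ suc (toℕ (right i))
  rights-between⇒adjacent {i} {j} j≡1+i allRight =
    nothing-between⇒≡suc (right-mono (ℕ.≤-reflexive (sym j≡1+i))) λ m i<m m<j →
      let e = allRight m i<m m<j in
      no-index-between j≡1+i (right-reflects-< (subst (right i <_) (sym e) i<m))
                             (right-reflects-< (subst (_< right j) (sym e) m<j))

  twins-overlap-alike : ∀ {i j} → toℕ (left j) ≡ suc (toℕ (left i)) →
    toℕ (right j) ≡ suc (toℕ (right i)) → ∀ l → Overlap i l ⇔ Overlap j l
  twins-overlap-alike {i} {j} lefts rights l = mk⇔ to from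
    where
    to : Overlap i l → Overlap j l
    to (li<rl , ll<ri) =
        Fin.≤∧≢⇒< (subst (ℕ._≤ toℕ (right l)) (sym lefts) li<rl) (left≢right j l)
      , ℕ.<-trans ll<ri (ℕ.≤-reflexive (sym rights))
    from : Overlap j l → Overlap i l
    from (lj<rl , ll<rj) =
        ℕ.<-trans (ℕ.≤-reflexive (sym lefts)) lj<rl
      , Fin.≤∧≢⇒< (ℕ.s≤s⁻¹ (subst (toℕ (left l) ℕ.<_) rights ll<rj)) (left≢right l i)

module _ {n : ℕ} where

  opposite-< : ∀ {i j : Fin n} → i < j → opposite j < opposite i
  opposite-< {i} {j} i<j rewrite Fin.opposite-prop i | Fin.opposite-prop j =
    ℕ.∸-monoʳ-< (s≤s i<j) (Fin.toℕ<n j)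

  opposite-≤ : ∀ {i j : Fin n} → i ≤ j → opposite j ≤ opposite i
  opposite-≤ {i} {j} i≤j rewrite Fin.opposite-prop i | Fin.opposite-prop j =
    ℕ.∸-monoʳ-≤ n (s≤s i≤j)

  opposite-swap : ∀ {i j : Fin n} → opposite i ≡ j → i ≡ opposite j
  opposite-swap {i} e = trans (sym (Fin.opposite-involutive i)) (cong opposite e)

  opposite-suc : ∀ {i j : Fin n} → toℕ j ≡ suc (toℕ i) →
                 toℕ (opposite i) ≡ suc (toℕ (opposite j))
  opposite-suc {i} {j} j≡1+i rewrite Fin.opposite-prop i | Fin.opposite-prop j | j≡1+i =
    ℕ.+-∸-assoc 1 (subst (ℕ._< n) j≡1+i (Fin.toℕ<n j))

  opposite-suc⁻¹ : ∀ {i j : Fin n} → toℕ (opposite i) ≡ suc (toℕ (opposite j)) →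
                   toℕ j ≡ suc (toℕ i)
  opposite-suc⁻¹ {i} {j} h
    with opposite-suc h
  ... | h′ rewrite Fin.opposite-involutive i | Fin.opposite-involutive j = h′

  toℕ-opposite : ∀ {i : Fin n} {c} → toℕ i ≡ c → toℕ (opposite i) ≡ n ∸ suc c
  toℕ-opposite {i} refl = Fin.opposite-prop i

  toℕ-opposite⁻¹ : ∀ {i : Fin n} {c} → toℕ (opposite i) ≡ c → toℕ i ≡ n ∸ suc c
  toℕ-opposite⁻¹ {i} h = subst (λ j → toℕ j ≡ _) (Fin.opposite-involutive i) (toℕ-opposite h)

  toℕ-opposite⇔ : ∀ {i : Fin n} {c} → c ℕ.< n → toℕ (opposite i) ≡ c ⇔ toℕ i ≡ n ∸ suc c
  toℕ-opposite⇔ {i} {c} c<n = mk⇔ toℕ-opposite⁻¹ from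
    where
    c′ : Fin n
    c′ = fromℕ< c<n
    from : toℕ i ≡ n ∸ suc c → toℕ (opposite i) ≡ c
    from h = begin
      toℕ (opposite i)            ≡⟨ cong (λ j → toℕ (opposite j)) i≡opposite-c′ ⟩
      toℕ (opposite (opposite c′)) ≡⟨ cong toℕ (Fin.opposite-involutive c′) ⟩
      toℕ c′                      ≡⟨ Fin.toℕ-fromℕ< c<n ⟩
      c                           ∎
      where
      open ≡-Reasoning
      i≡opposite-c′ : i ≡ opposite c′
      i≡opposite-c′ = Fin.toℕ-injective (trans h (sym (toℕ-opposite (Fin.toℕ-fromℕ< c<n))))

module _ {p n} (E : EndpointSequence p n) where
  open EndpointSequence E

  ConsecutiveOverlap : Set
  ConsecutiveOverlap = ∀ i j → toℕ j ≡ suc (toℕ i) → left j < right i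

  NoTwins : Set
  NoTwins = ∀ i j → toℕ j ≡ suc (toℕ i) →
            toℕ (left j) ≡ suc (toℕ (left i)) → toℕ (right j) ≡ suc (toℕ (right i)) → ⊥

  reverse : EndpointSequence p n
  reverse = record
    { lab           = λ k → opposite (lab (opposite k))
    ; left          = λ i → opposite (right (opposite i))
    ; right         = λ i → opposite (left (opposite i))
    ; lab-left      = λ i → lab-opposite (right (opposite i)) (lab-right (opposite i))
    ; lab-right     = λ i → lab-opposite (left (opposite i)) (lab-left (opposite i))
    ; left-or-right = left-or-right′
    ; left<right    = λ i → opposite-< (left<right (opposite i))
    ; left-mono     = λ i<j → opposite-< (right-mono (opposite-< i<j))
    ; right-mono    = λ i<j → opposite-< (left-mono (opposite-< i<j))
    }
    where
    lab-opposite : ∀ k {i} → lab k ≡ opposite i → opposite (lab (opposite (opposite k))) ≡ i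
    lab-opposite k {i} e rewrite Fin.opposite-involutive k | e = Fin.opposite-involutive i

    left-or-right′ : ∀ k → opposite (right (opposite (opposite (lab (opposite k))))) ≡ k
                         ⊎ opposite (left (opposite (opposite (lab (opposite k))))) ≡ k
    left-or-right′ k rewrite Fin.opposite-involutive (lab (opposite k))
      with left-or-right (opposite k)
    ... | inj₁ e = inj₂ (sym (opposite-swap (sym e)))
    ... | inj₂ e = inj₁ (sym (opposite-swap (sym e)))

module _ {p n} {E : EndpointSequence p n} where

  reverse-consecutiveOverlap : ConsecutiveOverlap E → ConsecutiveOverlap (reverse E)
  reverse-consecutiveOverlap overlaps i j j≡1+i = opposite-< (overlaps _ _ (opposite-suc j≡1+i))

  reverse-noTwins : NoTwins E → NoTwins (reverse E)
  reverse-noTwins noTwins i j j≡1+i lefts rights =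
    noTwins _ _ (opposite-suc j≡1+i) (opposite-suc⁻¹ rights) (opposite-suc⁻¹ lefts)

module _ {p n} (E : EndpointSequence p n) (S : Fin p → Set) where
  open EndpointSequence E

  Perfect : Fin n → Fin n → Set
  Perfect s t = s ≤ t × (∀ k → InSub s t k → S (lab k)) ×
                (∀ i → S i → ∃[ k ] (InSub s t k × lab k ≡ i))

  -- Case1 and Case2, with S the neighbourhood of w read through the ordering u.
  AtFront : Set
  AtFront =
    (∃[ k₀ ] ∃[ k₁ ] ∃[ k₂ ]
       ((toℕ k₀ ≡ 0) × (toℕ k₁ ≡ 1) × (toℕ k₂ ≡ 2) ×
        (toℕ (lab k₀) ≡ 0) × (toℕ (lab k₁) ≡ 1) × (toℕ (lab k₂) ≡ 0))) ×
    (∀ i → S i ⇔ ((toℕ i ≡ 0) ⊎ (toℕ i ≡ 1)))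

  AtBack : Set
  AtBack =
    (∃[ k₀ ] ∃[ k₁ ] ∃[ k₂ ]
       ((toℕ k₀ ≡ n ∸ 3) × (toℕ k₁ ≡ n ∸ 2) × (toℕ k₂ ≡ n ∸ 1) ×
        (toℕ (lab k₀) ≡ p ∸ 1) × (toℕ (lab k₁) ≡ p ∸ 2) × (toℕ (lab k₂) ≡ p ∸ 1))) ×
    (∀ i → S i ⇔ ((toℕ i ≡ p ∸ 2) ⊎ (toℕ i ≡ p ∸ 1)))

InSub-opposite : ∀ {n} {s t k : Fin n} → InSub s t k → InSub (opposite t) (opposite s) (opposite k)
InSub-opposite (s≤k , k≤t) = opposite-≤ k≤t , opposite-≤ s≤k

InSub-opposite⁻¹ : ∀ {n} {s t k : Fin n} → InSub (opposite t) (opposite s) k → InSub s t (opposite k)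
InSub-opposite⁻¹ {s = s} {t} k∈ with InSub-opposite k∈
... | k∈′ rewrite Fin.opposite-involutive s | Fin.opposite-involutive t = k∈′

module _ {p n} {E : EndpointSequence p n} {S : Fin p → Set} where
  open EndpointSequence E

  reverse-perfect : ∀ {s t} → Perfect E S s t → Perfect (reverse E) (S ∘ opposite) (opposite t) (opposite s)
  reverse-perfect (s≤t , inside , covered) = opposite-≤ s≤t , inside′ , covered′
    where
    inside′ : ∀ k → InSub (opposite _) (opposite _) k → S (opposite (opposite (lab (opposite k))))
    inside′ k k∈ rewrite Fin.opposite-involutive (lab (opposite k)) =
      inside (opposite k) (InSub-opposite⁻¹ k∈)
    covered′ : ∀ i → S (opposite i) →
               ∃[ k ] (InSub (opposite _) (opposite _) k × opposite (lab (opposite k)) ≡ i)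
    covered′ i Si with covered (opposite i) Si
    ... | k , k∈ , e = opposite k , InSub-opposite k∈ , sym (opposite-swap (sym lab≡))
      where
      lab≡ : lab (opposite (opposite k)) ≡ opposite i
      lab≡ = trans (cong lab (Fin.opposite-involutive k)) e

  reverse-front⇒back : AtFront (reverse E) (S ∘ opposite) → AtBack E S
  reverse-front⇒back ((k₀ , k₁ , k₂ , k₀≡ , k₁≡ , k₂≡ , l₀ , l₁ , l₂) , nbrs) =
    ( opposite k₂ , opposite k₁ , opposite k₀
    , toℕ-opposite k₂≡ , toℕ-opposite k₁≡ , toℕ-opposite k₀≡
    , toℕ-opposite⁻¹ l₂ , toℕ-opposite⁻¹ l₁ , toℕ-opposite⁻¹ l₀ )
    , λ i → mk⇔ (to i) (from i)
    where
    1<p : 1 ℕ.< p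
    1<p = subst (ℕ._< p) l₁ (Fin.toℕ<n _)
    last⇔ : ∀ {i : Fin p} → toℕ (opposite i) ≡ 0 ⇔ toℕ i ≡ p ∸ 1
    last⇔ = toℕ-opposite⇔ (ℕ.<-trans ℕ.z<s 1<p)
    last-but-one⇔ : ∀ {i : Fin p} → toℕ (opposite i) ≡ 1 ⇔ toℕ i ≡ p ∸ 2
    last-but-one⇔ = toℕ-opposite⇔ 1<p
    nbrs′ : ∀ i → S i ⇔ ((toℕ (opposite i) ≡ 0) ⊎ (toℕ (opposite i) ≡ 1))
    nbrs′ i = subst (λ j → S j ⇔ ((toℕ (opposite i) ≡ 0) ⊎ (toℕ (opposite i) ≡ 1)))
                    (Fin.opposite-involutive i) (nbrs (opposite i))
    to : ∀ i → S i → (toℕ i ≡ p ∸ 2) ⊎ (toℕ i ≡ p ∸ 1)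
    to i Si with Equivalence.to (nbrs′ i) Si
    ... | inj₁ h = inj₂ (Equivalence.to last⇔ h)
    ... | inj₂ h = inj₁ (Equivalence.to last-but-one⇔ h)
    from : ∀ i → (toℕ i ≡ p ∸ 2) ⊎ (toℕ i ≡ p ∸ 1) → S i
    from i (inj₁ h) = Equivalence.from (nbrs′ i) (inj₂ (Equivalence.from last-but-one⇔ h))
    from i (inj₂ h) = Equivalence.from (nbrs′ i) (inj₁ (Equivalence.from last⇔ h))

module TouchingWindows {p n} (E : EndpointSequence p n) (noTwins : NoTwins E)
  (S : Fin p → Set) {s k t : Fin n} (before : Perfect E S s k) (after : Perfect E S k t) where
  open EndpointSequenceProperties E

  x : Fin p
  x = lab k

  inside : ∀ {m} → s ≤ m → m ≤ t → S (lab m)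
  inside {m} s≤m m≤t with ℕ.≤-total (toℕ m) (toℕ k)
  ... | inj₁ m≤k = proj₁ (proj₂ before) m (s≤m , m≤k)
  ... | inj₂ k≤m = proj₁ (proj₂ after) m (k≤m , m≤t)

  both-sides : ∀ {i} → S i → i ≢ x → s ≤ left i × left i < k × k < right i × right i ≤ t
  both-sides {i} Si i≢x with proj₂ (proj₂ before) i Si | proj₂ (proj₂ after) i Si
  ... | m₁ , (s≤m₁ , m₁≤k) , e₁ | m₂ , (k≤m₂ , m₂≤t) , e₂ =
    bounds (ordered-occurrences e₁ e₂ (ℕ.<-trans m₁<k k<m₂))
    where
    m₁<k : m₁ < k
    m₁<k = Fin.≤∧≢⇒< m₁≤k (λ m₁≡k → i≢x (trans (sym e₁) (cong lab m₁≡k)))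
    k<m₂ : k < m₂
    k<m₂ = Fin.≤∧≢⇒< k≤m₂ (λ k≡m₂ → i≢x (trans (sym e₂) (cong lab (sym k≡m₂))))
    bounds : m₁ ≡ left i × m₂ ≡ right i → s ≤ left i × left i < k × k < right i × right i ≤ t
    bounds (refl , refl) = s≤m₁ , m₁<k , k<m₂ , m₂≤t

  left≤k : ∀ {i} → S i → left i ≤ k
  left≤k {i} Si with i Fin.≟ x
  ... | no i≢x = ℕ.<⇒≤ (proj₁ (proj₂ (both-sides Si i≢x)))
  ... | yes refl with occurrence {k} refl
  ...   | inj₁ k≡left = ℕ.≤-reflexive (cong toℕ (sym k≡left))
  ...   | inj₂ k≡right = ℕ.<⇒≤ (subst (left x <_) (sym k≡right) (left<right x))

  k≤right : ∀ {i} → S i → k ≤ right i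
  k≤right {i} Si with i Fin.≟ x
  ... | no i≢x = ℕ.<⇒≤ (proj₁ (proj₂ (proj₂ (both-sides Si i≢x))))
  ... | yes refl with occurrence {k} refl
  ...   | inj₁ k≡left = ℕ.<⇒≤ (subst (_< right x) (sym k≡left) (left<right x))
  ...   | inj₂ k≡right = ℕ.≤-reflexive (cong toℕ k≡right)

  before-k-is-left : ∀ {m} → s ≤ m → m < k → left (lab m) ≡ m
  before-k-is-left {m} s≤m m<k with occurrence {m} refl
  ... | inj₁ m≡left = sym m≡left
  ... | inj₂ m≡right = ⊥-elim (ℕ.<⇒≱ m<k (subst (k ≤_) (sym m≡right)
                                 (k≤right (inside s≤m (ℕ.<⇒≤ (ℕ.<-≤-trans m<k (proj₁ after)))))))

  after-k-is-right : ∀ {m} → k < m → m ≤ t → right (lab m) ≡ m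
  after-k-is-right {m} k<m m≤t with occurrence {m} refl
  ... | inj₂ m≡right = sym m≡right
  ... | inj₁ m≡left = ⊥-elim (ℕ.<⇒≱ k<m (subst (_≤ k) (sym m≡left)
                                 (left≤k (inside (ℕ.<⇒≤ (ℕ.≤-<-trans (proj₁ before) k<m)) m≤t))))

  no-consecutive-neighbours : ∀ {i j} → toℕ j ≡ suc (toℕ i) → S i → S j → i ≢ x → j ≢ x → ⊥
  no-consecutive-neighbours {i} {j} j≡1+i Si Sj i≢x j≢x =
    noTwins i j j≡1+i
      (lefts-between⇒adjacent j≡1+i λ m i<m m<j →
         before-k-is-left (ℕ.<⇒≤ (ℕ.≤-<-trans s≤left-i i<m)) (ℕ.<-trans m<j left-j<k))
      (rights-between⇒adjacent j≡1+i λ m i<m m<j →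
         after-k-is-right (ℕ.<-trans k<right-i i<m) (ℕ.<⇒≤ (ℕ.<-≤-trans m<j right-j≤t)))
    where
    s≤left-i = proj₁ (both-sides Si i≢x)
    k<right-i = proj₁ (proj₂ (proj₂ (both-sides Si i≢x)))
    left-j<k = proj₁ (proj₂ (both-sides Sj j≢x))
    right-j≤t = proj₂ (proj₂ (proj₂ (both-sides Sj j≢x)))

  module AtLeftEndpoint (overlaps : ConsecutiveOverlap E) (k≡left : left x ≡ k)
                        {y : Fin p} (Sy : S y) (y≢x : y ≢ x) where

    below-x : ∀ {i} → S i → i ≢ x → i < x
    below-x Si i≢x = left-reflects-< (subst (left _ <_) (sym k≡left) (proj₁ (proj₂ (both-sides Si i≢x))))

    predecessor : Σ (Fin p) λ z → toℕ x ≡ suc (toℕ z)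
    predecessor = ∃-predecessor (ℕ.≤-<-trans z≤n (below-x Sy y≢x))

    z : Fin p
    z = proj₁ predecessor

    x≡1+z : toℕ x ≡ suc (toℕ z)
    x≡1+z = proj₂ predecessor

    z<x : z < x
    z<x = ℕ.≤-reflexive (sym x≡1+z)

    z≢x : z ≢ x
    z≢x = Fin.<⇒≢ z<x

    Sz : S z
    Sz = subst S (lab-left z) (inside s≤left-z left-z≤t)
      where
      s≤left-z = ℕ.≤-trans (proj₁ (both-sides Sy y≢x))
                           (strictMono-mono-≤ left-mono (ℕ.s≤s⁻¹ (subst (toℕ y ℕ.<_) x≡1+z (below-x Sy y≢x))))
      left-z≤t = ℕ.<⇒≤ (ℕ.<-≤-trans (subst (left z <_) k≡left (left-mono z<x)) (proj₁ after))

    -- A predecessor z′ of z would be a neighbour too, since right z′ lies inside the window by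
    -- connectivity, and z′, z would be twins.
    z≡0 : toℕ z ≡ 0
    z≡0 = ℕ.n≤0⇒n≡0 (ℕ.≮⇒≥ λ 0<z → twins (∃-predecessor 0<z))
      where
      twins : Σ (Fin p) (λ z′ → toℕ z ≡ suc (toℕ z′)) → ⊥
      twins (z′ , z≡1+z′) = no-consecutive-neighbours z≡1+z′ Sz′ Sz z′≢x z≢x
        where
        bounds = both-sides Sz z≢x
        z′<z : z′ < z
        z′<z = ℕ.≤-reflexive (sym z≡1+z′)
        z′≢x : z′ ≢ x
        z′≢x = Fin.<⇒≢ (ℕ.<-trans z′<z z<x)
        Sz′ : S z′
        Sz′ = subst S (lab-right z′)
          (inside (ℕ.<⇒≤ (ℕ.≤-<-trans (proj₁ bounds) (overlaps z′ z z≡1+z′)))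
                  (ℕ.<⇒≤ (ℕ.<-≤-trans (right-mono z′<z) (proj₂ (proj₂ (proj₂ bounds))))))

    x≡1 : toℕ x ≡ 1
    x≡1 = trans x≡1+z (cong suc z≡0)

    neighbours : ∀ i → S i ⇔ ((toℕ i ≡ 0) ⊎ (toℕ i ≡ 1))
    neighbours i = mk⇔ to from
      where
      to : S i → (toℕ i ≡ 0) ⊎ (toℕ i ≡ 1)
      to Si with i Fin.≟ x
      ... | yes refl = inj₂ x≡1
      ... | no i≢x = inj₁ (ℕ.n<1⇒n≡0 (subst (toℕ i ℕ.<_) x≡1 (below-x Si i≢x)))
      from : (toℕ i ≡ 0) ⊎ (toℕ i ≡ 1) → S i
      from (inj₁ i≡0) = subst S (Fin.toℕ-injective (trans z≡0 (sym i≡0))) Sz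
      from (inj₂ i≡1) = subst S (Fin.toℕ-injective (trans x≡1 (sym i≡1))) (inside (proj₁ before) (proj₁ after))

    k≡1 : toℕ k ≡ 1
    k≡1 = begin
      toℕ k              ≡⟨ cong toℕ (sym k≡left) ⟩
      toℕ (left x)       ≡⟨ lefts-between⇒adjacent x≡1+z all-left ⟩
      suc (toℕ (left z)) ≡⟨ cong suc (left-first z z≡0) ⟩
      1                  ∎
      where
      open ≡-Reasoning
      all-left : ∀ m → left z < m → m < left x → left (lab m) ≡ m
      all-left m z<m m<x = before-k-is-left (ℕ.≤-trans (proj₁ (both-sides Sz z≢x)) (ℕ.<⇒≤ z<m))
                                            (subst (m <_) k≡left m<x)

    right-z≡2 : toℕ (right z) ≡ 2
    right-z≡2 = trans (nothing-between⇒≡suc k<right-z nothing) (cong suc k≡1)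
      where
      bounds = both-sides Sz z≢x
      k<right-z = proj₁ (proj₂ (proj₂ bounds))
      nothing : ∀ m → k < m → m < right z → ⊥
      nothing m k<m m<right-z = neither (Equivalence.to (neighbours (lab m)) (inside s≤m m≤t))
        where
        s≤m = ℕ.<⇒≤ (ℕ.≤-<-trans (proj₁ before) k<m)
        m≤t = ℕ.<⇒≤ (ℕ.<-≤-trans m<right-z (proj₂ (proj₂ (proj₂ bounds))))
        m≡right : ∀ {i} → lab m ≡ i → m ≡ right i
        m≡right refl = sym (after-k-is-right k<m m≤t)
        neither : (toℕ (lab m) ≡ 0) ⊎ (toℕ (lab m) ≡ 1) → ⊥
        neither (inj₁ h) = ℕ.<-irrefl (cong toℕ (m≡right (Fin.toℕ-injective (trans h (sym z≡0))))) m<right-z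
        neither (inj₂ h) = ℕ.<-asym m<right-z
          (subst (right z <_) (sym (m≡right (Fin.toℕ-injective (trans h (sym x≡1))))) (right-mono z<x))

    atFront : AtFront E S
    atFront = ( left z , k , right z , left-first z z≡0 , k≡1 , right-z≡2
              , trans (cong toℕ (lab-left z)) z≡0 , x≡1 , trans (cong toℕ (lab-right z)) z≡0 )
            , neighbours

module _ {p n} {E : EndpointSequence p n} (overlaps : ConsecutiveOverlap E) (noTwins : NoTwins E)
         {S : Fin p → Set} where
  open EndpointSequenceProperties E

  touching-windows : ∀ {s k t} → Perfect E S s k → Perfect E S k t →
                     ∃[ y ] (S y × y ≢ lab k) → AtFront E S ⊎ AtBack E S
  -- If k is the right occurrence of its label, it is the left one in the reversed sequence.
  touching-windows {s} {k} {t} before after (y , Sy , y≢x) with occurrence {k} refl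
  ... | inj₁ k≡left = inj₁ (TouchingWindows.AtLeftEndpoint.atFront
          E noTwins S before after overlaps (sym k≡left) Sy y≢x)
  ... | inj₂ k≡right = inj₂ (reverse-front⇒back {E = E} (TouchingWindows.AtLeftEndpoint.atFront
          (reverse E) (reverse-noTwins {E = E} noTwins) (S ∘ opposite)
          (reverse-perfect {E = E} after) (reverse-perfect {E = E} before)
          (reverse-consecutiveOverlap {E = E} overlaps) k′≡left Sy′ y′≢x′))
    where
    x′≡ : opposite (lab (opposite (opposite k))) ≡ opposite (lab k)
    x′≡ = cong (λ m → opposite (lab m)) (Fin.opposite-involutive k)
    k′≡left : opposite (right (opposite (opposite (lab (opposite (opposite k)))))) ≡ opposite k
    k′≡left rewrite Fin.opposite-involutive k | Fin.opposite-involutive (lab k) = cong opposite (sym k≡right)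
    Sy′ : S (opposite (opposite y))
    Sy′ = subst S (sym (Fin.opposite-involutive y)) Sy
    y′≢x′ : opposite y ≢ opposite (lab (opposite (opposite k)))
    y′≢x′ e = y≢x (trans (opposite-swap e) (trans (cong opposite x′≡) (Fin.opposite-involutive (lab k))))

module _ {n : ℕ} {s₁ t₁ s₂ t₂ : Fin n} where

  meetInOnePlace-sym : MeetInOnePlace s₁ t₁ s₂ t₂ → MeetInOnePlace s₂ t₂ s₁ t₁
  meetInOnePlace-sym ((k , k∈₁ , k∈₂) , unique) =
    (k , k∈₂ , k∈₁) , λ l l′ (l∈₂ , l∈₁) (l′∈₂ , l′∈₁) → unique l l′ (l∈₁ , l∈₂) (l′∈₁ , l′∈₂)

  meetInOnePlace⇒touching : MeetInOnePlace s₁ t₁ s₂ t₂ → s₁ ≤ s₂ → s₂ ≡ t₁ ⊎ s₂ ≡ t₂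
  meetInOnePlace⇒touching ((k , (s₁≤k , k≤t₁) , (s₂≤k , k≤t₂)) , unique) s₁≤s₂
    with ℕ.≤-total (toℕ t₁) (toℕ t₂)
  ... | inj₁ t₁≤t₂ = inj₁ (unique s₂ t₁ ((s₁≤s₂ , s₂≤t₁) , (ℕ.≤-refl , s₂≤t₂))
                                          ((s₁≤t₁ , ℕ.≤-refl) , (s₂≤t₁ , t₁≤t₂)))
    where
    s₁≤t₁ = ℕ.≤-trans s₁≤k k≤t₁
    s₂≤t₁ = ℕ.≤-trans s₂≤k k≤t₁
    s₂≤t₂ = ℕ.≤-trans s₂≤k k≤t₂
  ... | inj₂ t₂≤t₁ = inj₂ (unique s₂ t₂ ((s₁≤s₂ , ℕ.≤-trans s₂≤t₂ t₂≤t₁) , (ℕ.≤-refl , s₂≤t₂))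
                                          ((ℕ.≤-trans s₁≤s₂ s₂≤t₂ , t₂≤t₁) , (s₂≤t₂ , ℕ.≤-refl)))
    where
    s₂≤t₂ = ℕ.≤-trans s₂≤k k≤t₂

module _ {p n} {E : EndpointSequence p n} {S : Fin p → Set} where
  open EndpointSequence E

  perfect-singleton : ∀ {s i j} → Perfect E S s s → S i → S j → i ≡ j
  perfect-singleton (_ , _ , covered) Si Sj
    with covered _ Si | covered _ Sj
  ... | kᵢ , (s≤kᵢ , kᵢ≤s) , eᵢ | kⱼ , (s≤kⱼ , kⱼ≤s) , eⱼ =
    trans (sym eᵢ) (trans (cong lab kᵢ≡kⱼ) eⱼ)
    where
    kᵢ≡kⱼ = Fin.toℕ-injective (trans (ℕ.≤-antisym kᵢ≤s s≤kᵢ) (ℕ.≤-antisym s≤kⱼ kⱼ≤s))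

another : ∀ {p} {S : Fin p → Set} → ∃[ i ] ∃[ j ] (i ≢ j × S i × S j) → ∀ x → ∃[ y ] (S y × y ≢ x)
another (i , j , i≢j , Si , Sj) x with i Fin.≟ x
... | yes refl = j , Sj , λ j≡i → i≢j (sym j≡i)
... | no i≢x = i , Si , i≢x

module _ {p n} {E : EndpointSequence p n} (overlaps : ConsecutiveOverlap E) (noTwins : NoTwins E)
         {S : Fin p → Set} (two : ∃[ i ] ∃[ j ] (i ≢ j × S i × S j)) where

  perfect-not-singleton : ∀ {s} → Perfect E S s s → ⊥
  perfect-not-singleton pf = let i , j , i≢j , Si , Sj = two in i≢j (perfect-singleton {E = E} pf Si Sj)

  perfect-meeting-once-from-left : ∀ {s₁ t₁ s₂ t₂} → Perfect E S s₁ t₁ → Perfect E S s₂ t₂ →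
    MeetInOnePlace s₁ t₁ s₂ t₂ → s₁ ≤ s₂ → AtFront E S ⊎ AtBack E S
  perfect-meeting-once-from-left pf₁ pf₂ meet s₁≤s₂
    with meetInOnePlace⇒touching meet s₁≤s₂
  ... | inj₁ refl = touching-windows {E = E} overlaps noTwins {S = S} pf₁ pf₂ (another two _)
  ... | inj₂ refl = ⊥-elim (perfect-not-singleton pf₂)

  perfect-meeting-once : ∀ {s₁ t₁ s₂ t₂} → Perfect E S s₁ t₁ → Perfect E S s₂ t₂ →
                         MeetInOnePlace s₁ t₁ s₂ t₂ → AtFront E S ⊎ AtBack E S
  perfect-meeting-once {s₁} {_} {s₂} pf₁ pf₂ meet with ℕ.≤-total (toℕ s₁) (toℕ s₂)
  ... | inj₁ s₁≤s₂ = perfect-meeting-once-from-left pf₁ pf₂ meet s₁≤s₂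
  ... | inj₂ s₂≤s₁ = perfect-meeting-once-from-left pf₂ pf₁ (meetInOnePlace-sym meet) s₂≤s₁

Reach-closed : ∀ {A : Set} {R : A → A → Set} (C : A → Set) → (∀ {x y} → R x y → C x → C y) →
               ∀ {x y} → Reach R x y → C x → C y
Reach-closed C closed here Cx = Cx
Reach-closed C closed (step Rxy rest) Cx = Reach-closed C closed rest (closed Rxy Cx)

module FromCanonicalOrdering {p q} (G : SimpleGraph (Vtx p q)) {u : Fin p → Fin p} {a b : Fin p → ℚ}
  (co : IsCanonicalOrdering G u a b) {V : Fin (p + p) → Fin p} (vs : IsVertexCanonicalSequence a b V) where
  open IsCanonicalOrdering co

  σ : Fin (p + p) → Fin (p + p)
  σ = proj₁ vs

  σ-injective : ∀ {k l} → σ k ≡ σ l → k ≡ l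
  σ-injective = proj₁ (proj₁ (proj₂ vs))

  σ-surjective : Surjective _≡_ _≡_ σ
  σ-surjective = proj₂ (proj₁ (proj₂ vs))

  endpoint-mono : ∀ {k l} → k < l → endpoint a b (σ k) ℚ.< endpoint a b (σ l)
  endpoint-mono = proj₁ (proj₂ (proj₂ vs)) _ _

  leftPos rightPos : Fin p → Fin (p + p)
  leftPos i = proj₁ (σ-surjective (i ↑ˡ p))
  rightPos i = proj₁ (σ-surjective (p ↑ʳ i))

  σ-leftPos : ∀ i → σ (leftPos i) ≡ i ↑ˡ p
  σ-leftPos i = proj₂ (σ-surjective (i ↑ˡ p)) refl

  σ-rightPos : ∀ i → σ (rightPos i) ≡ p ↑ʳ i
  σ-rightPos i = proj₂ (σ-surjective (p ↑ʳ i)) refl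

  endpoint-leftPos : ∀ i → endpoint a b (σ (leftPos i)) ≡ a i
  endpoint-leftPos i rewrite σ-leftPos i | Fin.splitAt-↑ˡ p i p = refl

  endpoint-rightPos : ∀ i → endpoint a b (σ (rightPos i)) ≡ b i
  endpoint-rightPos i rewrite σ-rightPos i | Fin.splitAt-↑ʳ p p i = refl

  V≡ : ∀ k → V k ≡ [ id , id ]′ (Fin.splitAt p (σ k))
  V≡ = proj₂ (proj₂ (proj₂ vs))

  V-leftPos : ∀ i → V (leftPos i) ≡ i
  V-leftPos i rewrite V≡ (leftPos i) | σ-leftPos i | Fin.splitAt-↑ˡ p i p = refl

  V-rightPos : ∀ i → V (rightPos i) ≡ i
  V-rightPos i rewrite V≡ (rightPos i) | σ-rightPos i | Fin.splitAt-↑ʳ p p i = refl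

  leftPos-or-rightPos : ∀ k → leftPos (V k) ≡ k ⊎ rightPos (V k) ≡ k
  leftPos-or-rightPos k with Fin.splitAt p (σ k) in eq
  ... | inj₁ i = inj₁ (trans (cong leftPos (trans (V≡ k) (cong [ id , id ]′ eq)))
                        (σ-injective (trans (σ-leftPos i) (Fin.splitAt⁻¹-↑ˡ eq))))
  ... | inj₂ i = inj₂ (trans (cong rightPos (trans (V≡ k) (cong [ id , id ]′ eq)))
                        (σ-injective (trans (σ-rightPos i) (Fin.splitAt⁻¹-↑ʳ eq))))

  endpoint-reflects-< : ∀ {k l} → endpoint a b (σ k) ℚ.< endpoint a b (σ l) → k < l
  endpoint-reflects-< = strictMono-reflects-< ℚ.<-irrefl ℚ.<-asym endpoint-mono

  a≤b⇔leftPos<rightPos : ∀ i j → a i ℚ.≤ b j ⇔ leftPos i < rightPos j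
  a≤b⇔leftPos<rightPos i j = mk⇔ to from
    where
    to : a i ℚ.≤ b j → leftPos i < rightPos j
    to ai≤bj with ℚ.<-cmp (a i) (b j)
    ... | tri< ai<bj _ _ = endpoint-reflects-< (subst₂ ℚ._<_ (sym (endpoint-leftPos i)) (sym (endpoint-rightPos j)) ai<bj)
    ... | tri≈ _ ai≡bj _ = ⊥-elim (a≢b i j ai≡bj)
    ... | tri> _ _ bj<ai = ⊥-elim (ℚ.<-irrefl refl (ℚ.<-≤-trans bj<ai ai≤bj))
    from : leftPos i < rightPos j → a i ℚ.≤ b j
    from l<r = ℚ.<⇒≤ (subst₂ ℚ._<_ (endpoint-leftPos i) (endpoint-rightPos j) (endpoint-mono l<r))

  endpointSequence : EndpointSequence p (p + p)
  endpointSequence = record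
    { lab           = V
    ; left          = leftPos
    ; right         = rightPos
    ; lab-left      = V-leftPos
    ; lab-right     = V-rightPos
    ; left-or-right = leftPos-or-rightPos
    ; left<right    = λ i → Equivalence.to (a≤b⇔leftPos<rightPos i i) (a≤b i)
    ; left-mono     = λ {i} {j} i<j → endpoint-reflects-<
        (subst₂ ℚ._<_ (sym (endpoint-leftPos i)) (sym (endpoint-leftPos j)) (a-mono i j i<j))
    ; right-mono    = λ {i} {j} i<j → endpoint-reflects-<
        (subst₂ ℚ._<_ (sym (endpoint-rightPos i)) (sym (endpoint-rightPos j)) (b-mono i j i<j))
    }

  open EndpointSequenceProperties endpointSequence using (Overlap; left≢right; twins-overlap-alike)

  u-injective : ∀ {i j} → u i ≡ u j → i ≡ j
  u-injective = proj₁ u-bij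

  u⁻¹ : Fin p → Fin p
  u⁻¹ v = proj₁ (proj₂ u-bij v)

  u∘u⁻¹ : ∀ v → u (u⁻¹ v) ≡ v
  u∘u⁻¹ v = proj₂ (proj₂ u-bij v) refl

  u⁻¹∘u : ∀ i → u⁻¹ (u i) ≡ i
  u⁻¹∘u i = u-injective (u∘u⁻¹ (u i))

  adjacent⇔overlap : ∀ {i j} → i ≢ j → AdjP G (u i) (u j) ⇔ Overlap i j
  adjacent⇔overlap {i} {j} i≢j = ⇔-trans (rep i j i≢j)
    (mk⇔ (λ (ai≤bj , aj≤bi) → to (a≤b⇔leftPos<rightPos i j) ai≤bj , to (a≤b⇔leftPos<rightPos j i) aj≤bi)
         (λ (li<rj , lj<ri) → from (a≤b⇔leftPos<rightPos i j) li<rj , from (a≤b⇔leftPos<rightPos j i) lj<ri))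
    where open Equivalence

  adjacent⇒overlap : ∀ {v w} → AdjP G v w → Overlap (u⁻¹ v) (u⁻¹ w)
  adjacent⇒overlap {v} {w} v~w = Equivalence.to (adjacent⇔overlap u⁻¹v≢u⁻¹w)
    (subst₂ (AdjP G) (sym (u∘u⁻¹ v)) (sym (u∘u⁻¹ w)) v~w)
    where
    u⁻¹v≢u⁻¹w : u⁻¹ v ≢ u⁻¹ w
    u⁻¹v≢u⁻¹w e = irrefl G (subst (AdjP G v) (trans (sym (u∘u⁻¹ w)) (trans (cong u (sym e)) (u∘u⁻¹ v))) v~w)

  closedNbhd⇔overlap : ∀ i j → NbhdP G (u i) (u j) ⇔ Overlap i j
  closedNbhd⇔overlap i j with j Fin.≟ i
  ... | yes refl = mk⇔ (λ _ → left<right i , left<right i) (λ _ → inj₁ refl)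
    where open EndpointSequence endpointSequence using (left<right)
  ... | no j≢i = mk⇔ to (inj₂ ∘ Equivalence.from (adjacent⇔overlap (j≢i ∘ sym)))
    where
    to : NbhdP G (u i) (u j) → Overlap i j
    to (inj₁ uj≡ui) = ⊥-elim (j≢i (u-injective uj≡ui))
    to (inj₂ ui~uj) = Equivalence.to (adjacent⇔overlap (j≢i ∘ sym)) ui~uj

  connected⇒consecutiveOverlap : ConnectedP G → ConsecutiveOverlap endpointSequence
  connected⇒consecutiveOverlap connected i j j≡1+i = Fin.≤∧≢⇒< (ℕ.≮⇒≥ separated) (left≢right j i)
    where
    open EndpointSequence endpointSequence using (left-mono; right-mono)
    -- A gap between u_i and its successor would leave no edge from u_i and its predecessors
    -- to the rest of G_P.
    separated : rightPos i < leftPos j → ⊥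
    separated gap = ℕ.<⇒≱ (ℕ.≤-reflexive (sym j≡1+i)) (subst (_≤ i) (u⁻¹∘u j) reach-j)
      where
      AtMostI : Fin p → Set
      AtMostI v = u⁻¹ v ≤ i
      closed : ∀ {v w} → AdjP G v w → AtMostI v → AtMostI w
      closed {v} {w} v~w u⁻¹v≤i = ℕ.≮⇒≥ λ i<u⁻¹w → ℕ.<-irrefl refl (begin-strict
        toℕ (leftPos (u⁻¹ w))  <⟨ proj₂ (adjacent⇒overlap v~w) ⟩
        toℕ (rightPos (u⁻¹ v)) ≤⟨ strictMono-mono-≤ right-mono u⁻¹v≤i ⟩
        toℕ (rightPos i)       <⟨ gap ⟩
        toℕ (leftPos j)        ≤⟨ strictMono-mono-≤ left-mono (subst (ℕ._≤ toℕ (u⁻¹ w)) (sym j≡1+i) i<u⁻¹w) ⟩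
        toℕ (leftPos (u⁻¹ w))  ∎)
        where open ℕ.≤-Reasoning
      reach-j : AtMostI (u j)
      reach-j = Reach-closed AtMostI closed (connected (u i) (u j)) (ℕ.≤-reflexive (cong toℕ (u⁻¹∘u i)))

  reduced⇒noTwins : ReducedP G → NoTwins endpointSequence
  reduced⇒noTwins reduced i j j≡1+i lefts rights = ℕ.1+n≢n (sym (trans (cong toℕ i≡j) j≡1+i))
    where
    sameNbhd : ∀ z → NbhdP G (u i) z ⇔ NbhdP G (u j) z
    sameNbhd z = subst (λ z → NbhdP G (u i) z ⇔ NbhdP G (u j) z) (u∘u⁻¹ z)
      (⇔-trans (closedNbhd⇔overlap i (u⁻¹ z))
        (⇔-trans (twins-overlap-alike lefts rights (u⁻¹ z)) (⇔-sym (closedNbhd⇔overlap j (u⁻¹ z)))))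
    i≡j : i ≡ j
    i≡j = u-injective (reduced (u i) (u j) sameNbhd)

  module _ (w : Fin q) where

    Nbr : Fin p → Set
    Nbr i = NbrW G w (u i)

    perfectSub⇒perfect : ∀ {s t} → PerfectSub G u V w s t → Perfect endpointSequence Nbr s t
    perfectSub⇒perfect (s≤t , inside , covered) = s≤t , inside , λ i Si →
      let k , k∈ , uVk≡ui = covered (u i) Si in k , k∈ , u-injective uVk≡ui

    twoNbrs⇒twoIndices : TwoNbrs G w → ∃[ i ] ∃[ j ] (i ≢ j × Nbr i × Nbr j)
    twoNbrs⇒twoIndices (v , v′ , v≢v′ , v~w , v′~w) =
        u⁻¹ v , u⁻¹ v′ , (λ e → v≢v′ (trans (sym (u∘u⁻¹ v)) (trans (cong u e) (u∘u⁻¹ v′))))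
      , subst (NbrW G w) (sym (u∘u⁻¹ v)) v~w , subst (NbrW G w) (sym (u∘u⁻¹ v′)) v′~w

lemma3p9 : ∀ {p q : ℕ} (G : SimpleGraph (Vtx p q)) → IsProperTPIG G →
           ConnectedP G → ReducedP G →
           (u : Fin p → Fin p) (a b : Fin p → ℚ) → IsCanonicalOrdering G u a b →
           (V : Fin (p + p) → Fin p) → IsVertexCanonicalSequence a b V →
           (w : Fin q) → TwoNbrs G w →
           (s₁ t₁ s₂ t₂ : Fin (p + p)) →
           PerfectSub G u V w s₁ t₁ → PerfectSub G u V w s₂ t₂ →
           MeetInOnePlace s₁ t₁ s₂ t₂ →
           Case1 G u V w ⊎ Case2 G u V w
lemma3p9 G _ connected reduced u a b co V vs w two s₁ t₁ s₂ t₂ perfect₁ perfect₂ meet =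
  perfect-meeting-once {E = endpointSequence} (connected⇒consecutiveOverlap connected) (reduced⇒noTwins reduced)
    {S = Nbr w} (twoNbrs⇒twoIndices w two) (perfectSub⇒perfect w perfect₁) (perfectSub⇒perfect w perfect₂) meet
  where open FromCanonicalOrdering G co vs
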